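{- Let $\mathcal{R}=\{\beta,\mu,\rho,\theta,\varepsilon\}$ and let $M,N$ be $\lambda\mu$-terms. (1) If $x$ is a $\lambda$-variable and $M[x:=N]\in\mathcal{SN}_{\mathcal{R}}$, then $M\in\mathcal{SN}_{\mathcal{R}}$. (2) If $\alpha$ is a $\mu$-variable and $M[\alpha:=_rN]\in\mathcal{SN}_{\mathcal{R}}$, then $M\in\mathcal{SN}_{\mathcal{R}}$.
   Context: $\lambda\mu$-terms: $\mathcal{T} ::= x \mid \lambda x.\mathcal{T} \mid (\mathcal{T})\mathcal{T} \mid [\alpha]\mathcal{T} \mid \mu\alpha.\mathcal{T}$ ($x$ $\lambda$-variables, $\alpha$ $\mu$-variables), up to renaming of bound variables; substitutions avoid capture. $M[x:=N]$ usual substitution; $M[\alpha:=\beta]$ renames free $\alpha$ to $\beta$; $M[\alpha:=_rN]$ replaces inductively every subterm $[\alpha]P$ by $[\alpha](P')N$, $P'$ the substituted $P$; $M_\alpha$ replaces inductively each $[\alpha]P$ by $P$. Rules: $\beta$: $(\lambda x.M)N\to M[x:=N]$; $\mu$: $(\mu\alpha.M)N\to\mu\alpha.M[\alpha:=_rN]$; $\rho$: $[\beta]\mu\alpha.M\to M[\alpha:=\beta]$; $\theta$: $\mu\alpha.[\alpha]M\to M$ if $\alpha\notin\mathrm{fv}(M)$; $\varepsilon$: $\mu\alpha.\mu\beta.M\to\mu\alpha.M_\beta$. One-step reduction contracts one redex anywhere in a term; $\mathcal{SN}_{\mathcal{R}}$ = terms with no infinite $\mathcal{R}$-reduction sequence.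 -}

module Defs where

open import Data.Nat using (ℕ; zero; suc; _≡ᵇ_; _<ᵇ_; pred)
open import Data.Bool using (if_then_else_)
open import Data.Product using (Σ; _×_)
open import Relation.Binary.PropositionalEquality using (_≡_)
open import Relation.Nullary using (¬_)

-- λμ-terms with de Bruijn indices; λ-variables and μ-variables are two
-- separate namespaces, each with its own indices.
--   var n   : λ-variable
--   lam M   : λx.M       (binds λ-index 0 in M)
--   app M N : (M)N
--   nam a M : [α]M       (a is the μ-index of α)
--   mu M    : μα.M       (binds μ-index 0 in M)
data Term : Set where
  var : ℕ → Term
  lam : Term → Term
  app : Term → Term → Term
  nam : ℕ → Term → Term
  mu  : Term → Term

ext : (ℕ → ℕ) → ℕ → ℕ
ext ρ zero    = zero
ext ρ (suc n) = suc (ρ n)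

renλ : (ℕ → ℕ) → Term → Term
renλ ρ (var n)   = var (ρ n)
renλ ρ (lam M)   = lam (renλ (ext ρ) M)
renλ ρ (app M N) = app (renλ ρ M) (renλ ρ N)
renλ ρ (nam a M) = nam a (renλ ρ M)
renλ ρ (mu M)    = mu (renλ ρ M)

renμ : (ℕ → ℕ) → Term → Term
renμ ρ (var n)   = var n
renμ ρ (lam M)   = lam (renμ ρ M)
renμ ρ (app M N) = app (renμ ρ M) (renμ ρ N)
renμ ρ (nam a M) = nam (ρ a) (renμ ρ M)
renμ ρ (mu M)    = mu (renμ (ext ρ) M)

extsλ : (ℕ → Term) → ℕ → Term
extsλ σ zero    = var zero
extsλ σ (suc n) = renλ suc (σ n)

substλ : (ℕ → Term) → Term → Term
substλ σ (var n)   = σ n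
substλ σ (lam M)   = lam (substλ (extsλ σ) M)
substλ σ (app M N) = app (substλ σ M) (substλ σ N)
substλ σ (nam a M) = nam a (substλ σ M)
substλ σ (mu M)    = mu (substλ (λ n → renμ suc (σ n)) M)

_[_:=_] : Term → ℕ → Term → Term
M [ x := N ] = substλ (λ n → if n ≡ᵇ x then N else var n) M

-- M[α:=_r N] for the μ-variable with index α: every [α]P becomes [α](P')N
_[_:=r_] : Term → ℕ → Term → Term
var n   [ k :=r N ] = var n
lam M   [ k :=r N ] = lam (M [ k :=r renλ suc N ])
app M P [ k :=r N ] = app (M [ k :=r N ]) (P [ k :=r N ])
nam a M [ k :=r N ] =
  if a ≡ᵇ k then nam a (app (M [ k :=r N ]) N) else nam a (M [ k :=r N ])
mu M    [ k :=r N ] = mu (M [ suc k :=r renμ suc N ])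

-- M_β for the μ-variable with index k: every [β]P becomes P; since β then no
-- longer occurs, its binder is removed and higher μ-indices are decremented.
erase : ℕ → Term → Term
erase k (var n)   = var n
erase k (lam M)   = lam (erase k M)
erase k (app M N) = app (erase k M) (erase k N)
erase k (nam a M) =
  if a ≡ᵇ k then erase k M
  else (if a <ᵇ k then nam a (erase k M) else nam (pred a) (erase k M))
erase k (mu M)    = mu (erase (suc k) M)

ρren : ℕ → ℕ → ℕ
ρren b zero    = b
ρren b (suc n) = n

infix 4 _⟶_
data _⟶_ : Term → Term → Set where
  β    : ∀ {M N} → app (lam M) N ⟶ substλ (λ { zero → N ; (suc n) → var n }) M
  μr   : ∀ {M N} → app (mu M) N ⟶ mu (M [ 0 :=r renμ suc N ])
  ρr   : ∀ {b M} → nam b (mu M) ⟶ renμ (ρren b) M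
  -- θ: μα.[α]M → M with α ∉ fv(M)  (M written as renμ suc M, i.e. not using index 0)
  θr   : ∀ {M} → mu (nam 0 (renμ suc M)) ⟶ M
  εr   : ∀ {M} → mu (mu M) ⟶ mu (erase 0 M)
  lamξ : ∀ {M M'} → M ⟶ M' → lam M ⟶ lam M'
  appl : ∀ {M M' N} → M ⟶ M' → app M N ⟶ app M' N
  appr : ∀ {M N N'} → N ⟶ N' → app M N ⟶ app M N'
  namξ : ∀ {a M M'} → M ⟶ M' → nam a M ⟶ nam a M'
  muξ  : ∀ {M M'} → M ⟶ M' → mu M ⟶ mu M'

SN : Term → Set
SN M = ¬ (Σ (ℕ → Term) λ f → (f 0 ≡ M) × (∀ i → f i ⟶ f (suc i)))

-- Both parts are simulations. A λ-substitution maps each step M ⟶ M' to a step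
-- M[σ] ⟶ M'[σ], and a structural substitution maps it to a nonempty reduction
-- M[α:=rN] ⟶⁺ M'[α:=rN]: the only rule needing more than one step is ρ on [α]μγ.P,
-- which becomes [α](μγ.P')N and first has to take a μ-step. So an infinite reduction
-- from M yields one from the substituted term. Each rule case amounts to a commutation
-- law between the substitution and the operation in the contractum (λ-substitution,
-- structural substitution, μ-renaming, erasure M_β).

module Submission where

open import Defs
open import Data.Nat using (ℕ; zero; suc; _≡ᵇ_; _<ᵇ_; pred)
open import Data.Nat.Properties using (≡ᵇ⇒≡)
open import Data.Bool using (true; false; T; if_then_else_; _∨_)
open import Data.Empty using (⊥-elim)
open import Data.Product using (Σ; _×_; _,_)
open import Data.Sum using (_⊎_; inj₁; inj₂)
open import Function using (_∘_; id)
open import Relation.Binary.PropositionalEquality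
open ≡-Reasoning
open import Relation.Binary.Core using (Rel; _=[_]⇒_)
open import Relation.Binary.Construct.Closure.Transitive using (TransClosure; [_]; _∷_)
open import Level using (Level)

private
  variable
    a b ℓ₁ ℓ₂ : Level
    A B : Set a

TransClosure-map : ∀ {R : Rel A ℓ₁} {S : Rel B ℓ₂} {f : A → B}
                 → R =[ f ]⇒ S → TransClosure R =[ f ]⇒ TransClosure S
TransClosure-map h [ x∼y ]      = [ h x∼y ]
TransClosure-map h (x∼y ∷ y∼⁺z) = h x∼y ∷ TransClosure-map h y∼⁺z

InfiniteChain : Rel A ℓ₁ → A → Set _
InfiniteChain {A = A} R x = Σ (ℕ → A) λ f → f 0 ≡ x × (∀ i → R (f i) (f (suc i)))

InfiniteChain-map : ∀ {R : Rel A ℓ₁} {S : Rel B ℓ₂} (f : A → B) → R =[ f ]⇒ S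
                  → ∀ {x} → InfiniteChain R x → InfiniteChain S (f x)
InfiniteChain-map f h (g , g0≡x , g-step) = f ∘ g , cong f g0≡x , h ∘ g-step

InfiniteChain-flatten : ∀ {R : Rel A ℓ₁} {x} → InfiniteChain (TransClosure R) x → InfiniteChain R x
InfiniteChain-flatten {A = A} {R = R} (g , g0≡x , g-step) =
  term ∘ position , g0≡x , term-advance ∘ position
  where
  -- A position (j , t , p) is a point t of the flattened chain, with p the remaining path to g j.
  Position : Set _
  Position = Σ ℕ λ j → Σ A λ t → TransClosure R t (g j)

  advance : Position → Position
  advance (j , t , [ _ ])             = suc j , g j , g-step j
  advance (j , t , _∷_ {y = u} _ u∼⁺) = j , u , u∼⁺

  term : Position → A
  term (_ , t , _) = t

  term-advance : ∀ p → R (term p) (term (advance p))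
  term-advance (_ , _ , [ t∼ ]) = t∼
  term-advance (_ , _ , t∼ ∷ _) = t∼

  position : ℕ → Position
  position zero    = 1 , g 0 , g-step 0
  position (suc i) = advance (position i)

↑λ ↑μ : Term → Term
↑λ = renλ suc
↑μ = renμ suc

-- Defs writes the β-contractum with an anonymous substitution, equal to sub₀ N only
-- pointwise; the β lemmas below therefore accept any τ ≗ sub₀ N.
sub₀ : Term → ℕ → Term
sub₀ N zero    = N
sub₀ N (suc n) = var n

ext-cong : ∀ {ρ ρ'} → ρ ≗ ρ' → ext ρ ≗ ext ρ'
ext-cong h zero    = refl
ext-cong h (suc n) = cong suc (h n)

renλ-cong : ∀ {ρ ρ'} → ρ ≗ ρ' → renλ ρ ≗ renλ ρ'
renλ-cong h (var n)   = cong var (h n)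
renλ-cong h (lam t)   = cong lam (renλ-cong (ext-cong h) t)
renλ-cong h (app t u) = cong₂ app (renλ-cong h t) (renλ-cong h u)
renλ-cong h (nam a t) = cong (nam a) (renλ-cong h t)
renλ-cong h (mu t)    = cong mu (renλ-cong h t)

renμ-cong : ∀ {ρ ρ'} → ρ ≗ ρ' → renμ ρ ≗ renμ ρ'
renμ-cong h (var n)   = refl
renμ-cong h (lam t)   = cong lam (renμ-cong h t)
renμ-cong h (app t u) = cong₂ app (renμ-cong h t) (renμ-cong h u)
renμ-cong h (nam a t) = cong₂ nam (h a) (renμ-cong h t)
renμ-cong h (mu t)    = cong mu (renμ-cong (ext-cong h) t)

extsλ-cong : ∀ {σ σ'} → σ ≗ σ' → extsλ σ ≗ extsλ σ'
extsλ-cong h zero    = refl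
extsλ-cong h (suc n) = cong ↑λ (h n)

substλ-cong : ∀ {σ σ'} → σ ≗ σ' → substλ σ ≗ substλ σ'
substλ-cong h (var n)   = h n
substλ-cong h (lam t)   = cong lam (substλ-cong (extsλ-cong h) t)
substλ-cong h (app t u) = cong₂ app (substλ-cong h t) (substλ-cong h u)
substλ-cong h (nam a t) = cong (nam a) (substλ-cong h t)
substλ-cong h (mu t)    = cong mu (substλ-cong (cong ↑μ ∘ h) t)

ext-∘ : ∀ ρ ρ' → ext ρ ∘ ext ρ' ≗ ext (ρ ∘ ρ')
ext-∘ ρ ρ' zero    = refl
ext-∘ ρ ρ' (suc n) = refl

renλ-∘ : ∀ ρ ρ' → renλ ρ ∘ renλ ρ' ≗ renλ (ρ ∘ ρ')
renλ-∘ ρ ρ' (var n)   = refl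
renλ-∘ ρ ρ' (lam t)   =
  cong lam (trans (renλ-∘ (ext ρ) (ext ρ') t) (renλ-cong (ext-∘ ρ ρ') t))
renλ-∘ ρ ρ' (app t u) = cong₂ app (renλ-∘ ρ ρ' t) (renλ-∘ ρ ρ' u)
renλ-∘ ρ ρ' (nam a t) = cong (nam a) (renλ-∘ ρ ρ' t)
renλ-∘ ρ ρ' (mu t)    = cong mu (renλ-∘ ρ ρ' t)

renμ-∘ : ∀ ρ ρ' → renμ ρ ∘ renμ ρ' ≗ renμ (ρ ∘ ρ')
renμ-∘ ρ ρ' (var n)   = refl
renμ-∘ ρ ρ' (lam t)   = cong lam (renμ-∘ ρ ρ' t)
renμ-∘ ρ ρ' (app t u) = cong₂ app (renμ-∘ ρ ρ' t) (renμ-∘ ρ ρ' u)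
renμ-∘ ρ ρ' (nam a t) = cong (nam (ρ (ρ' a))) (renμ-∘ ρ ρ' t)
renμ-∘ ρ ρ' (mu t)    =
  cong mu (trans (renμ-∘ (ext ρ) (ext ρ') t) (renμ-cong (ext-∘ ρ ρ') t))

ext-id : ∀ {ρ} → ρ ≗ id → ext ρ ≗ id
ext-id h zero    = refl
ext-id h (suc n) = cong suc (h n)

renμ-id : ∀ {ρ} → ρ ≗ id → renμ ρ ≗ id
renμ-id h (var n)   = refl
renμ-id h (lam t)   = cong lam (renμ-id h t)
renμ-id h (app t u) = cong₂ app (renμ-id h t) (renμ-id h u)
renμ-id h (nam a t) = cong₂ nam (h a) (renμ-id h t)
renμ-id h (mu t)    = cong mu (renμ-id (ext-id h) t)

substλ-id : ∀ {σ} → σ ≗ var → substλ σ ≗ id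
substλ-id h (var n)   = h n
substλ-id h (lam t)   = cong lam (substλ-id (extsλ-var h) t)
  where
  extsλ-var : ∀ {σ} → σ ≗ var → extsλ σ ≗ var
  extsλ-var h zero    = refl
  extsλ-var h (suc n) = cong ↑λ (h n)
substλ-id h (app t u) = cong₂ app (substλ-id h t) (substλ-id h u)
substλ-id h (nam a t) = cong (nam a) (substλ-id h t)
substλ-id h (mu t)    = cong mu (substλ-id (cong ↑μ ∘ h) t)

renλ-renμ-comm : ∀ ρ ρ' → renλ ρ ∘ renμ ρ' ≗ renμ ρ' ∘ renλ ρ
renλ-renμ-comm ρ ρ' (var n)   = refl
renλ-renμ-comm ρ ρ' (lam t)   = cong lam (renλ-renμ-comm (ext ρ) ρ' t)
renλ-renμ-comm ρ ρ' (app t u) = cong₂ app (renλ-renμ-comm ρ ρ' t) (renλ-renμ-comm ρ ρ' u)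
renλ-renμ-comm ρ ρ' (nam a t) = cong (nam (ρ' a)) (renλ-renμ-comm ρ ρ' t)
renλ-renμ-comm ρ ρ' (mu t)    = cong mu (renλ-renμ-comm ρ (ext ρ') t)

renλ-ext-↑λ : ∀ ρ t → renλ (ext ρ) (↑λ t) ≡ ↑λ (renλ ρ t)
renλ-ext-↑λ ρ t = trans (renλ-∘ (ext ρ) suc t) (sym (renλ-∘ suc ρ t))

renμ-ext-↑μ : ∀ ρ t → renμ (ext ρ) (↑μ t) ≡ ↑μ (renμ ρ t)
renμ-ext-↑μ ρ t = trans (renμ-∘ (ext ρ) suc t) (sym (renμ-∘ suc ρ t))

substλ-renλ : ∀ σ ρ → substλ σ ∘ renλ ρ ≗ substλ (σ ∘ ρ)
substλ-renλ σ ρ (var n)   = refl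
substλ-renλ σ ρ (lam t)   =
  cong lam (trans (substλ-renλ (extsλ σ) (ext ρ) t) (substλ-cong extsλ-ext t))
  where
  extsλ-ext : extsλ σ ∘ ext ρ ≗ extsλ (σ ∘ ρ)
  extsλ-ext zero    = refl
  extsλ-ext (suc n) = refl
substλ-renλ σ ρ (app t u) = cong₂ app (substλ-renλ σ ρ t) (substλ-renλ σ ρ u)
substλ-renλ σ ρ (nam a t) = cong (nam a) (substλ-renλ σ ρ t)
substλ-renλ σ ρ (mu t)    = cong mu (substλ-renλ (↑μ ∘ σ) ρ t)

renλ-substλ : ∀ ρ σ → renλ ρ ∘ substλ σ ≗ substλ (renλ ρ ∘ σ)
renλ-substλ ρ σ (var n)   = refl
renλ-substλ ρ σ (lam t)   =
  cong lam (trans (renλ-substλ (ext ρ) (extsλ σ) t) (substλ-cong ext-extsλ t))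
  where
  ext-extsλ : renλ (ext ρ) ∘ extsλ σ ≗ extsλ (renλ ρ ∘ σ)
  ext-extsλ zero    = refl
  ext-extsλ (suc n) = renλ-ext-↑λ ρ (σ n)
renλ-substλ ρ σ (app t u) = cong₂ app (renλ-substλ ρ σ t) (renλ-substλ ρ σ u)
renλ-substλ ρ σ (nam a t) = cong (nam a) (renλ-substλ ρ σ t)
renλ-substλ ρ σ (mu t)    =
  cong mu (trans (renλ-substλ ρ (↑μ ∘ σ) t) (substλ-cong (renλ-renμ-comm ρ suc ∘ σ) t))

renμ-substλ : ∀ ρ σ t → renμ ρ (substλ σ t) ≡ substλ (renμ ρ ∘ σ) (renμ ρ t)
renμ-substλ ρ σ (var n)   = refl
renμ-substλ ρ σ (lam t)   =
  cong lam (trans (renμ-substλ ρ (extsλ σ) t) (substλ-cong renμ-extsλ (renμ ρ t)))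
  where
  renμ-extsλ : renμ ρ ∘ extsλ σ ≗ extsλ (renμ ρ ∘ σ)
  renμ-extsλ zero    = refl
  renμ-extsλ (suc n) = sym (renλ-renμ-comm suc ρ (σ n))
renμ-substλ ρ σ (app t u) = cong₂ app (renμ-substλ ρ σ t) (renμ-substλ ρ σ u)
renμ-substλ ρ σ (nam a t) = cong (nam (ρ a)) (renμ-substλ ρ σ t)
renμ-substλ ρ σ (mu t)    =
  cong mu (trans (renμ-substλ (ext ρ) (↑μ ∘ σ) t)
                 (substλ-cong (renμ-ext-↑μ ρ ∘ σ) (renμ (ext ρ) t)))

substλ-substλ : ∀ σ τ → substλ σ ∘ substλ τ ≗ substλ (substλ σ ∘ τ)
substλ-substλ σ τ (var n)   = refl
substλ-substλ σ τ (lam t)   =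
  cong lam (trans (substλ-substλ (extsλ σ) (extsλ τ) t) (substλ-cong extsλ-substλ t))
  where
  extsλ-substλ : substλ (extsλ σ) ∘ extsλ τ ≗ extsλ (substλ σ ∘ τ)
  extsλ-substλ zero    = refl
  extsλ-substλ (suc n) =
    trans (substλ-renλ (extsλ σ) suc (τ n)) (sym (renλ-substλ suc σ (τ n)))
substλ-substλ σ τ (app t u) = cong₂ app (substλ-substλ σ τ t) (substλ-substλ σ τ u)
substλ-substλ σ τ (nam a t) = cong (nam a) (substλ-substλ σ τ t)
substλ-substλ σ τ (mu t)    =
  cong mu (trans (substλ-substλ (↑μ ∘ σ) (↑μ ∘ τ) t)
                 (substλ-cong (sym ∘ renμ-substλ suc σ ∘ τ) t))

substλ-sub₀-↑λ : ∀ N t → substλ (sub₀ N) (↑λ t) ≡ t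
substλ-sub₀-↑λ N t = trans (substλ-renλ (sub₀ N) suc t) (substλ-id (λ _ → refl) t)

-- Unlike `with`, this split does not abstract m ≡ᵇ n in the goal, so equations such as
-- erase-nam-≡ still apply to both sides.
≡ᵇ-cases : ∀ m n → (m ≡ᵇ n) ≡ true ⊎ (m ≡ᵇ n) ≡ false
≡ᵇ-cases m n with m ≡ᵇ n
... | true  = inj₁ refl
... | false = inj₂ refl

≡ᵇ-true⇒≡ : ∀ m n → (m ≡ᵇ n) ≡ true → m ≡ n
≡ᵇ-true⇒≡ m n e = ≡ᵇ⇒≡ m n (subst T (sym e) _)

-- The new index of a μ-variable a ≢ k after erase k.
punchOut : ℕ → ℕ → ℕ
punchOut k a = if a <ᵇ k then a else pred a

punchOut-suc : ∀ a k → (a ≡ᵇ k) ≡ false → punchOut (suc k) (suc a) ≡ suc (punchOut k a)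
punchOut-suc zero    zero    ()
punchOut-suc zero    (suc k) _ = refl
punchOut-suc (suc a) k       _ with suc a <ᵇ k
... | true  = refl
... | false = refl

erase-nam-≡ : ∀ k a t → (a ≡ᵇ k) ≡ true → erase k (nam a t) ≡ erase k t
erase-nam-≡ k a t a≡k rewrite a≡k = refl

erase-nam-≢ : ∀ k a t → (a ≡ᵇ k) ≡ false → erase k (nam a t) ≡ nam (punchOut k a) (erase k t)
erase-nam-≢ k a t a≢k rewrite a≢k with a <ᵇ k
... | true  = refl
... | false = refl

erase-renλ-comm : ∀ k ρ → erase k ∘ renλ ρ ≗ renλ ρ ∘ erase k
erase-renλ-comm k ρ (var n)   = refl
erase-renλ-comm k ρ (lam t)   = cong lam (erase-renλ-comm k (ext ρ) t)
erase-renλ-comm k ρ (app t u) = cong₂ app (erase-renλ-comm k ρ t) (erase-renλ-comm k ρ u)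
erase-renλ-comm k ρ (nam a t) with a ≡ᵇ k | a <ᵇ k
... | true  | _     = erase-renλ-comm k ρ t
... | false | true  = cong (nam a) (erase-renλ-comm k ρ t)
... | false | false = cong (nam (pred a)) (erase-renλ-comm k ρ t)
erase-renλ-comm k ρ (mu t)    = cong mu (erase-renλ-comm (suc k) ρ t)

erase-renμ : ∀ k k' ρ ρ' → (∀ c → (ρ c ≡ᵇ k') ≡ (c ≡ᵇ k))
           → (∀ c → (c ≡ᵇ k) ≡ false → punchOut k' (ρ c) ≡ ρ' (punchOut k c))
           → erase k' ∘ renμ ρ ≗ renμ ρ' ∘ erase k
erase-renμ k k' ρ ρ' ρ⁻¹k' ρ-punchOut = go
  where
  go : erase k' ∘ renμ ρ ≗ renμ ρ' ∘ erase k
  go (var n)   = refl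
  go (lam t)   = cong lam (go t)
  go (app t u) = cong₂ app (go t) (go u)
  go (nam a t) with ≡ᵇ-cases a k
  ... | inj₁ a≡k = begin
    erase k' (nam (ρ a) (renμ ρ t)) ≡⟨ erase-nam-≡ k' (ρ a) (renμ ρ t) (trans (ρ⁻¹k' a) a≡k) ⟩
    erase k' (renμ ρ t)             ≡⟨ go t ⟩
    renμ ρ' (erase k t)             ≡⟨ cong (renμ ρ') (erase-nam-≡ k a t a≡k) ⟨
    renμ ρ' (erase k (nam a t))     ∎
  ... | inj₂ a≢k = begin
    erase k' (nam (ρ a) (renμ ρ t))
      ≡⟨ erase-nam-≢ k' (ρ a) (renμ ρ t) (trans (ρ⁻¹k' a) a≢k) ⟩
    nam (punchOut k' (ρ a)) (erase k' (renμ ρ t))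
      ≡⟨ cong₂ nam (ρ-punchOut a a≢k) (go t) ⟩
    renμ ρ' (nam (punchOut k a) (erase k t))
      ≡⟨ cong (renμ ρ') (erase-nam-≢ k a t a≢k) ⟨
    renμ ρ' (erase k (nam a t))
      ∎
  go (mu t)    = cong mu (erase-renμ (suc k) (suc k') (ext ρ) (ext ρ') ext-ρ⁻¹k' ext-ρ-punchOut t)
    where
    ext-ρ⁻¹k' : ∀ c → (ext ρ c ≡ᵇ suc k') ≡ (c ≡ᵇ suc k)
    ext-ρ⁻¹k' zero    = refl
    ext-ρ⁻¹k' (suc c) = ρ⁻¹k' c
    ext-ρ-punchOut : ∀ c → (c ≡ᵇ suc k) ≡ false
                   → punchOut (suc k') (ext ρ c) ≡ ext ρ' (punchOut (suc k) c)
    ext-ρ-punchOut zero    _   = refl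
    ext-ρ-punchOut (suc c) c≢k = begin
      punchOut (suc k') (suc (ρ c))   ≡⟨ punchOut-suc (ρ c) k' (trans (ρ⁻¹k' c) c≢k) ⟩
      suc (punchOut k' (ρ c))         ≡⟨ cong suc (ρ-punchOut c c≢k) ⟩
      suc (ρ' (punchOut k c))         ≡⟨ cong (ext ρ') (punchOut-suc c k c≢k) ⟨
      ext ρ' (punchOut (suc k) (suc c)) ∎

erase-↑μ : ∀ k → erase (suc k) ∘ ↑μ ≗ ↑μ ∘ erase k
erase-↑μ k = erase-renμ k (suc k) suc suc (λ _ → refl) (λ c → punchOut-suc c k)

erase-renμ-fresh : ∀ k ρ ρ' → (∀ c → (ρ c ≡ᵇ k) ≡ false) → punchOut k ∘ ρ ≗ ρ'
                 → erase k ∘ renμ ρ ≗ renμ ρ'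
erase-renμ-fresh k ρ ρ' k∉ρ ρ-punchOut (var n)   = refl
erase-renμ-fresh k ρ ρ' k∉ρ ρ-punchOut (lam t)   =
  cong lam (erase-renμ-fresh k ρ ρ' k∉ρ ρ-punchOut t)
erase-renμ-fresh k ρ ρ' k∉ρ ρ-punchOut (app t u) =
  cong₂ app (erase-renμ-fresh k ρ ρ' k∉ρ ρ-punchOut t) (erase-renμ-fresh k ρ ρ' k∉ρ ρ-punchOut u)
erase-renμ-fresh k ρ ρ' k∉ρ ρ-punchOut (nam a t) =
  trans (erase-nam-≢ k (ρ a) (renμ ρ t) (k∉ρ a))
        (cong₂ nam (ρ-punchOut a) (erase-renμ-fresh k ρ ρ' k∉ρ ρ-punchOut t))
erase-renμ-fresh k ρ ρ' k∉ρ ρ-punchOut (mu t)    =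
  cong mu (erase-renμ-fresh (suc k) (ext ρ) (ext ρ') k∉extρ extρ-punchOut t)
  where
  k∉extρ : ∀ c → (ext ρ c ≡ᵇ suc k) ≡ false
  k∉extρ zero    = refl
  k∉extρ (suc c) = k∉ρ c
  extρ-punchOut : punchOut (suc k) ∘ ext ρ ≗ ext ρ'
  extρ-punchOut zero    = refl
  extρ-punchOut (suc c) = trans (punchOut-suc (ρ c) k (k∉ρ c)) (cong suc (ρ-punchOut c))

erase₀-↑μ : ∀ t → erase 0 (↑μ t) ≡ t
erase₀-↑μ t = trans (erase-renμ-fresh 0 suc id (λ _ → refl) (λ _ → refl) t)
                    (renμ-id (λ _ → refl) t)

erase-substλ : ∀ k {τ τ'} → erase k ∘ τ ≗ τ' → erase k ∘ substλ τ ≗ substλ τ' ∘ erase k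
erase-substλ k h (var n)   = h n
erase-substλ k {τ} {τ'} h (lam t) = cong lam (erase-substλ k erase-extsλ t)
  where
  erase-extsλ : erase k ∘ extsλ τ ≗ extsλ τ'
  erase-extsλ zero    = refl
  erase-extsλ (suc n) = trans (erase-renλ-comm k suc (τ n)) (cong ↑λ (h n))
erase-substλ k h (app t u) = cong₂ app (erase-substλ k h t) (erase-substλ k h u)
erase-substλ k h (nam a t) with a ≡ᵇ k | a <ᵇ k
... | true  | _     = erase-substλ k h t
... | false | true  = cong (nam a) (erase-substλ k h t)
... | false | false = cong (nam (pred a)) (erase-substλ k h t)
erase-substλ k {τ} h (mu t)    =
  cong mu (erase-substλ (suc k) (λ n → trans (erase-↑μ k (τ n)) (cong ↑μ (h n))) t)

renλ-rsub : ∀ ρ k Q t → renλ ρ (t [ k :=r Q ]) ≡ (renλ ρ t) [ k :=r renλ ρ Q ]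
renλ-rsub ρ k Q (var n)   = refl
renλ-rsub ρ k Q (lam t)   = cong lam (trans (renλ-rsub (ext ρ) k (↑λ Q) t)
  (cong (renλ (ext ρ) t [ k :=r_]) (renλ-ext-↑λ ρ Q)))
renλ-rsub ρ k Q (app t u) = cong₂ app (renλ-rsub ρ k Q t) (renλ-rsub ρ k Q u)
renλ-rsub ρ k Q (nam a t) with a ≡ᵇ k
... | true  = cong (λ z → nam a (app z (renλ ρ Q))) (renλ-rsub ρ k Q t)
... | false = cong (nam a) (renλ-rsub ρ k Q t)
renλ-rsub ρ k Q (mu t)    = cong mu (trans (renλ-rsub ρ (suc k) (↑μ Q) t)
  (cong (renλ ρ t [ suc k :=r_]) (renλ-renμ-comm ρ suc Q)))

rsub-renμ : ∀ ρ a k A Q → (∀ c → (ρ c ≡ᵇ k) ≡ (c ≡ᵇ a)) → renμ ρ A ≡ Q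
          → ∀ t → (renμ ρ t) [ k :=r Q ] ≡ renμ ρ (t [ a :=r A ])
rsub-renμ ρ a k A Q ρ⁻¹k ρA (var n)   = refl
rsub-renμ ρ a k A Q ρ⁻¹k ρA (lam t)   = cong lam (rsub-renμ ρ a k (↑λ A) (↑λ Q) ρ⁻¹k
  (trans (sym (renλ-renμ-comm suc ρ A)) (cong ↑λ ρA)) t)
rsub-renμ ρ a k A Q ρ⁻¹k ρA (app t u) =
  cong₂ app (rsub-renμ ρ a k A Q ρ⁻¹k ρA t) (rsub-renμ ρ a k A Q ρ⁻¹k ρA u)
rsub-renμ ρ a k A Q ρ⁻¹k ρA (nam c t) rewrite ρ⁻¹k c with c ≡ᵇ a
... | true  = cong₂ (λ z w → nam (ρ c) (app z w)) (rsub-renμ ρ a k A Q ρ⁻¹k ρA t) (sym ρA)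
... | false = cong (nam (ρ c)) (rsub-renμ ρ a k A Q ρ⁻¹k ρA t)
rsub-renμ ρ a k A Q ρ⁻¹k ρA (mu t)    = cong mu (rsub-renμ (ext ρ) (suc a) (suc k) (↑μ A) (↑μ Q)
  ext-ρ⁻¹k (trans (renμ-ext-↑μ ρ A) (cong ↑μ ρA)) t)
  where
  ext-ρ⁻¹k : ∀ c → (ext ρ c ≡ᵇ suc k) ≡ (c ≡ᵇ suc a)
  ext-ρ⁻¹k zero    = refl
  ext-ρ⁻¹k (suc c) = ρ⁻¹k c

rsub-↑μ : ∀ k Q t → (↑μ t) [ suc k :=r ↑μ Q ] ≡ ↑μ (t [ k :=r Q ])
rsub-↑μ k Q = rsub-renμ suc k (suc k) Q (↑μ Q) (λ _ → refl) refl

rsub-renμ-fresh : ∀ ρ k Q → (∀ c → (ρ c ≡ᵇ k) ≡ false)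
                → ∀ t → (renμ ρ t) [ k :=r Q ] ≡ renμ ρ t
rsub-renμ-fresh ρ k Q k∉ρ (var n)   = refl
rsub-renμ-fresh ρ k Q k∉ρ (lam t)   = cong lam (rsub-renμ-fresh ρ k (↑λ Q) k∉ρ t)
rsub-renμ-fresh ρ k Q k∉ρ (app t u) =
  cong₂ app (rsub-renμ-fresh ρ k Q k∉ρ t) (rsub-renμ-fresh ρ k Q k∉ρ u)
rsub-renμ-fresh ρ k Q k∉ρ (nam c t) rewrite k∉ρ c = cong (nam (ρ c)) (rsub-renμ-fresh ρ k Q k∉ρ t)
rsub-renμ-fresh ρ k Q k∉ρ (mu t)    = cong mu (rsub-renμ-fresh (ext ρ) (suc k) (↑μ Q) k∉extρ t)
  where
  k∉extρ : ∀ c → (ext ρ c ≡ᵇ suc k) ≡ false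
  k∉extρ zero    = refl
  k∉extρ (suc c) = k∉ρ c

rsub-rsub-comm : ∀ a b A B A' → a ≢ b → A [ b :=r B ] ≡ A' → B [ a :=r A' ] ≡ B
               → ∀ t → (t [ a :=r A ]) [ b :=r B ] ≡ (t [ b :=r B ]) [ a :=r A' ]
rsub-rsub-comm a b A B A' a≢b hA hB (var n)   = refl
rsub-rsub-comm a b A B A' a≢b hA hB (lam t)   =
  cong lam (rsub-rsub-comm a b (↑λ A) (↑λ B) (↑λ A') a≢b
    (trans (sym (renλ-rsub suc b B A)) (cong ↑λ hA)) (trans (sym (renλ-rsub suc a A' B)) (cong ↑λ hB)) t)
rsub-rsub-comm a b A B A' a≢b hA hB (app t u) =
  cong₂ app (rsub-rsub-comm a b A B A' a≢b hA hB t) (rsub-rsub-comm a b A B A' a≢b hA hB u)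
rsub-rsub-comm a b A B A' a≢b hA hB (nam c t) with c ≡ᵇ a in c≡a | c ≡ᵇ b in c≡b
... | true  | true  = ⊥-elim (a≢b (trans (sym (≡ᵇ-true⇒≡ c a c≡a)) (≡ᵇ-true⇒≡ c b c≡b)))
... | true  | false rewrite c≡a | c≡b =
  cong₂ (λ z w → nam c (app z w)) (rsub-rsub-comm a b A B A' a≢b hA hB t) hA
... | false | true  rewrite c≡a | c≡b =
  cong₂ (λ z w → nam c (app z w)) (rsub-rsub-comm a b A B A' a≢b hA hB t) (sym hB)
... | false | false rewrite c≡a | c≡b =
  cong (nam c) (rsub-rsub-comm a b A B A' a≢b hA hB t)
rsub-rsub-comm a b A B A' a≢b hA hB (mu t)    =
  cong mu (rsub-rsub-comm (suc a) (suc b) (↑μ A) (↑μ B) (↑μ A') (a≢b ∘ cong pred)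
    (trans (rsub-↑μ b B A) (cong ↑μ hA)) (trans (rsub-↑μ a A' B) (cong ↑μ hB)) t)

rsub-renμ-merge : ∀ ρ a b k A B Q → (∀ c → (ρ c ≡ᵇ k) ≡ ((c ≡ᵇ a) ∨ (c ≡ᵇ b))) → a ≢ b
                → renμ ρ A ≡ Q → renμ ρ (B [ a :=r A ]) ≡ Q
                → ∀ t → (renμ ρ t) [ k :=r Q ] ≡ renμ ρ ((t [ b :=r B ]) [ a :=r A ])
rsub-renμ-merge ρ a b k A B Q ρ⁻¹k a≢b ρA ρB (var n)   = refl
rsub-renμ-merge ρ a b k A B Q ρ⁻¹k a≢b ρA ρB (lam t)   =
  cong lam (rsub-renμ-merge ρ a b k (↑λ A) (↑λ B) (↑λ Q) ρ⁻¹k a≢b ρA' ρB' t)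
  where
  ρA' : renμ ρ (↑λ A) ≡ ↑λ Q
  ρA' = trans (sym (renλ-renμ-comm suc ρ A)) (cong ↑λ ρA)
  ρB' : renμ ρ ((↑λ B) [ a :=r ↑λ A ]) ≡ ↑λ Q
  ρB' = begin
    renμ ρ ((↑λ B) [ a :=r ↑λ A ]) ≡⟨ cong (renμ ρ) (renλ-rsub suc a A B) ⟨
    renμ ρ (↑λ (B [ a :=r A ]))    ≡⟨ renλ-renμ-comm suc ρ _ ⟨
    ↑λ (renμ ρ (B [ a :=r A ]))    ≡⟨ cong ↑λ ρB ⟩
    ↑λ Q                           ∎
rsub-renμ-merge ρ a b k A B Q ρ⁻¹k a≢b ρA ρB (app t u) =
  cong₂ app (rsub-renμ-merge ρ a b k A B Q ρ⁻¹k a≢b ρA ρB t)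
            (rsub-renμ-merge ρ a b k A B Q ρ⁻¹k a≢b ρA ρB u)
rsub-renμ-merge ρ a b k A B Q ρ⁻¹k a≢b ρA ρB (nam c t)
  rewrite ρ⁻¹k c with c ≡ᵇ a in c≡a | c ≡ᵇ b in c≡b
... | true  | true  = ⊥-elim (a≢b (trans (sym (≡ᵇ-true⇒≡ c a c≡a)) (≡ᵇ-true⇒≡ c b c≡b)))
... | true  | false rewrite c≡a = cong₂ (λ z w → nam (ρ c) (app z w))
  (rsub-renμ-merge ρ a b k A B Q ρ⁻¹k a≢b ρA ρB t) (sym ρA)
... | false | true  rewrite c≡a = cong₂ (λ z w → nam (ρ c) (app z w))
  (rsub-renμ-merge ρ a b k A B Q ρ⁻¹k a≢b ρA ρB t) (sym ρB)
... | false | false rewrite c≡a = cong (nam (ρ c)) (rsub-renμ-merge ρ a b k A B Q ρ⁻¹k a≢b ρA ρB t)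
rsub-renμ-merge ρ a b k A B Q ρ⁻¹k a≢b ρA ρB (mu t)    =
  cong mu (rsub-renμ-merge (ext ρ) (suc a) (suc b) (suc k) (↑μ A) (↑μ B) (↑μ Q) ext-ρ⁻¹k
    (a≢b ∘ cong pred) (trans (renμ-ext-↑μ ρ A) (cong ↑μ ρA)) ρB' t)
  where
  ext-ρ⁻¹k : ∀ c → (ext ρ c ≡ᵇ suc k) ≡ ((c ≡ᵇ suc a) ∨ (c ≡ᵇ suc b))
  ext-ρ⁻¹k zero    = refl
  ext-ρ⁻¹k (suc c) = ρ⁻¹k c
  ρB' : renμ (ext ρ) ((↑μ B) [ suc a :=r ↑μ A ]) ≡ ↑μ Q
  ρB' = begin
    renμ (ext ρ) ((↑μ B) [ suc a :=r ↑μ A ]) ≡⟨ cong (renμ (ext ρ)) (rsub-↑μ a A B) ⟩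
    renμ (ext ρ) (↑μ (B [ a :=r A ]))        ≡⟨ renμ-ext-↑μ ρ _ ⟩
    ↑μ (renμ ρ (B [ a :=r A ]))              ≡⟨ cong ↑μ ρB ⟩
    ↑μ Q                                     ∎

substλ-rsub : ∀ σ σ' k P Q → (∀ n → σ' n ≡ (σ n) [ k :=r Q ]) → substλ σ' P ≡ Q
            → ∀ t → substλ σ' (t [ k :=r P ]) ≡ (substλ σ t) [ k :=r Q ]
substλ-rsub σ σ' k P Q σ'≗ σ'P (var n)   = σ'≗ n
substλ-rsub σ σ' k P Q σ'≗ σ'P (lam t)   =
  cong lam (substλ-rsub (extsλ σ) (extsλ σ') k (↑λ P) (↑λ Q) extsλ-σ'≗ extsλ-σ'P t)
  where
  extsλ-σ'≗ : ∀ n → extsλ σ' n ≡ (extsλ σ n) [ k :=r ↑λ Q ]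
  extsλ-σ'≗ zero    = refl
  extsλ-σ'≗ (suc n) = trans (cong ↑λ (σ'≗ n)) (renλ-rsub suc k Q (σ n))
  extsλ-σ'P : substλ (extsλ σ') (↑λ P) ≡ ↑λ Q
  extsλ-σ'P = begin
    substλ (extsλ σ') (↑λ P) ≡⟨ substλ-renλ (extsλ σ') suc P ⟩
    substλ (↑λ ∘ σ') P       ≡⟨ renλ-substλ suc σ' P ⟨
    ↑λ (substλ σ' P)         ≡⟨ cong ↑λ σ'P ⟩
    ↑λ Q                     ∎
substλ-rsub σ σ' k P Q σ'≗ σ'P (app t u) =
  cong₂ app (substλ-rsub σ σ' k P Q σ'≗ σ'P t) (substλ-rsub σ σ' k P Q σ'≗ σ'P u)
substλ-rsub σ σ' k P Q σ'≗ σ'P (nam a t) with a ≡ᵇ k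
... | true  = cong₂ (λ z w → nam a (app z w)) (substλ-rsub σ σ' k P Q σ'≗ σ'P t) σ'P
... | false = cong (nam a) (substλ-rsub σ σ' k P Q σ'≗ σ'P t)
substλ-rsub σ σ' k P Q σ'≗ σ'P (mu t)    =
  cong mu (substλ-rsub (↑μ ∘ σ) (↑μ ∘ σ') (suc k) (↑μ P) (↑μ Q)
    (λ n → trans (cong ↑μ (σ'≗ n)) (sym (rsub-↑μ k Q (σ n))))
    (trans (sym (renμ-substλ suc σ' P)) (cong ↑μ σ'P)) t)

rsub-nam-≡ : ∀ a k t Q → (a ≡ᵇ k) ≡ true → (nam a t) [ k :=r Q ] ≡ nam a (app (t [ k :=r Q ]) Q)
rsub-nam-≡ a k t Q a≡k rewrite a≡k = refl

rsub-nam-≢ : ∀ a k t Q → (a ≡ᵇ k) ≡ false → (nam a t) [ k :=r Q ] ≡ nam a (t [ k :=r Q ])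
rsub-nam-≢ a k t Q a≢k rewrite a≢k = refl

erase-rsub : ∀ j a k Q Q' → (a ≡ᵇ j) ≡ false
           → (∀ c → (c ≡ᵇ j) ≡ false → (punchOut j c ≡ᵇ k) ≡ (c ≡ᵇ a)) → erase j Q ≡ Q'
           → ∀ t → erase j (t [ a :=r Q ]) ≡ (erase j t) [ k :=r Q' ]
erase-rsub j a k Q Q' a≢j punchOut⁻¹k jQ = go
  where
  go : ∀ t → erase j (t [ a :=r Q ]) ≡ (erase j t) [ k :=r Q' ]
  go (var n)   = refl
  go (lam t)   = cong lam (erase-rsub j a k (↑λ Q) (↑λ Q') a≢j punchOut⁻¹k
    (trans (erase-renλ-comm j suc Q) (cong ↑λ jQ)) t)
  go (app t u) = cong₂ app (go t) (go u)
  go (nam c t) with ≡ᵇ-cases c a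
  ... | inj₁ c≡a = begin
    erase j ((nam c t) [ a :=r Q ])
      ≡⟨ cong (erase j) (rsub-nam-≡ c a t Q c≡a) ⟩
    erase j (nam c (app (t [ a :=r Q ]) Q))
      ≡⟨ erase-nam-≢ j c (app (t [ a :=r Q ]) Q) c≢j ⟩
    nam (punchOut j c) (app (erase j (t [ a :=r Q ])) (erase j Q))
      ≡⟨ cong₂ (λ z w → nam (punchOut j c) (app z w)) (go t) jQ ⟩
    nam (punchOut j c) (app ((erase j t) [ k :=r Q' ]) Q')
      ≡⟨ rsub-nam-≡ (punchOut j c) k (erase j t) Q' (trans (punchOut⁻¹k c c≢j) c≡a) ⟨
    (nam (punchOut j c) (erase j t)) [ k :=r Q' ]
      ≡⟨ cong (_[ k :=r Q' ]) (erase-nam-≢ j c t c≢j) ⟨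
    (erase j (nam c t)) [ k :=r Q' ] ∎
    where
    c≢j : (c ≡ᵇ j) ≡ false
    c≢j rewrite ≡ᵇ-true⇒≡ c a c≡a = a≢j
  ... | inj₂ c≢a with ≡ᵇ-cases c j
  ... | inj₁ c≡j = begin
    erase j ((nam c t) [ a :=r Q ])  ≡⟨ cong (erase j) (rsub-nam-≢ c a t Q c≢a) ⟩
    erase j (nam c (t [ a :=r Q ]))  ≡⟨ erase-nam-≡ j c (t [ a :=r Q ]) c≡j ⟩
    erase j (t [ a :=r Q ])          ≡⟨ go t ⟩
    (erase j t) [ k :=r Q' ]         ≡⟨ cong (_[ k :=r Q' ]) (erase-nam-≡ j c t c≡j) ⟨
    (erase j (nam c t)) [ k :=r Q' ] ∎
  ... | inj₂ c≢j = begin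
    erase j ((nam c t) [ a :=r Q ])
      ≡⟨ cong (erase j) (rsub-nam-≢ c a t Q c≢a) ⟩
    erase j (nam c (t [ a :=r Q ]))
      ≡⟨ erase-nam-≢ j c (t [ a :=r Q ]) c≢j ⟩
    nam (punchOut j c) (erase j (t [ a :=r Q ]))
      ≡⟨ cong (nam (punchOut j c)) (go t) ⟩
    nam (punchOut j c) ((erase j t) [ k :=r Q' ])
      ≡⟨ rsub-nam-≢ (punchOut j c) k (erase j t) Q' (trans (punchOut⁻¹k c c≢j) c≢a) ⟨
    (nam (punchOut j c) (erase j t)) [ k :=r Q' ]
      ≡⟨ cong (_[ k :=r Q' ]) (erase-nam-≢ j c t c≢j) ⟨
    (erase j (nam c t)) [ k :=r Q' ]
      ∎
  go (mu t)    = cong mu (erase-rsub (suc j) (suc a) (suc k) (↑μ Q) (↑μ Q') a≢j punchOut⁻¹sk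
    (trans (erase-↑μ j Q) (cong ↑μ jQ)) t)
    where
    punchOut⁻¹sk : ∀ c → (c ≡ᵇ suc j) ≡ false → (punchOut (suc j) c ≡ᵇ suc k) ≡ (c ≡ᵇ suc a)
    punchOut⁻¹sk zero    _   = refl
    punchOut⁻¹sk (suc c) c≢j = trans (cong (_≡ᵇ suc k) (punchOut-suc c j c≢j)) (punchOut⁻¹k c c≢j)

β-sub₀ : ∀ {M N} → app (lam M) N ⟶ substλ (sub₀ N) M
β-sub₀ {M} = subst (app (lam M) _ ⟶_) (substλ-cong (λ { zero → refl ; (suc n) → refl }) M) β

renμ-ρren-↑μ : ∀ b t → renμ (ρren b) (↑μ t) ≡ t
renμ-ρren-↑μ b t = trans (renμ-∘ (ρren b) suc t) (renμ-id (λ _ → refl) t)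

substλ-β : ∀ σ M N {τ} → τ ≗ sub₀ N
         → app (lam (substλ (extsλ σ) M)) (substλ σ N) ⟶ substλ σ (substλ τ M)
substλ-β σ M N {τ} τ≗ = subst (_ ⟶_) contractum β-sub₀
  where
  sub₀-extsλ : substλ (sub₀ (substλ σ N)) ∘ extsλ σ ≗ substλ σ ∘ τ
  sub₀-extsλ zero    = cong (substλ σ) (sym (τ≗ zero))
  sub₀-extsλ (suc n) = trans (substλ-sub₀-↑λ _ (σ n)) (cong (substλ σ) (sym (τ≗ (suc n))))
  contractum : substλ (sub₀ (substλ σ N)) (substλ (extsλ σ) M) ≡ substλ σ (substλ τ M)
  contractum = begin
    substλ (sub₀ (substλ σ N)) (substλ (extsλ σ) M)   ≡⟨ substλ-substλ _ (extsλ σ) M ⟩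
    substλ (substλ (sub₀ (substλ σ N)) ∘ extsλ σ) M   ≡⟨ substλ-cong sub₀-extsλ M ⟩
    substλ (substλ σ ∘ τ) M                           ≡⟨ substλ-substλ σ τ M ⟨
    substλ σ (substλ τ M)                             ∎

substλ-μ : ∀ σ M N → substλ σ (app (mu M) N) ⟶ substλ σ (mu (M [ 0 :=r ↑μ N ]))
substλ-μ σ M N = subst (app (mu (substλ (↑μ ∘ σ) M)) (substλ σ N) ⟶_)
  (cong mu (sym (substλ-rsub (↑μ ∘ σ) (↑μ ∘ σ) 0 (↑μ N) (↑μ (substλ σ N))
    (λ n → sym (rsub-renμ-fresh suc 0 _ (λ _ → refl) (σ n))) (sym (renμ-substλ suc σ N)) M)))
  μr

substλ-ρ : ∀ σ b M → substλ σ (nam b (mu M)) ⟶ substλ σ (renμ (ρren b) M)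
substλ-ρ σ b M = subst (nam b (mu (substλ (↑μ ∘ σ) M)) ⟶_)
  (trans (renμ-substλ (ρren b) (↑μ ∘ σ) M) (substλ-cong (renμ-ρren-↑μ b ∘ σ) (renμ (ρren b) M)))
  ρr

substλ-ε : ∀ σ M → substλ σ (mu (mu M)) ⟶ substλ σ (mu (erase 0 M))
substλ-ε σ M = subst (mu (mu (substλ (↑μ ∘ ↑μ ∘ σ) M)) ⟶_)
  (cong mu (erase-substλ 0 (erase₀-↑μ ∘ ↑μ ∘ σ) M))
  εr

substλ-⟶ : ∀ σ {M M'} → M ⟶ M' → substλ σ M ⟶ substλ σ M'
substλ-⟶ σ (β {M} {N})  = substλ-β σ M N (λ { zero → refl ; (suc n) → refl })
substλ-⟶ σ (μr {M} {N}) = substλ-μ σ M N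
substλ-⟶ σ (ρr {b} {M}) = substλ-ρ σ b M
substλ-⟶ σ (θr {M})     = subst (λ t → mu (nam 0 t) ⟶ substλ σ M) (renμ-substλ suc σ M) θr
substλ-⟶ σ (εr {M})     = substλ-ε σ M
substλ-⟶ σ (lamξ s)     = lamξ (substλ-⟶ (extsλ σ) s)
substλ-⟶ σ (appl s)     = appl (substλ-⟶ σ s)
substλ-⟶ σ (appr s)     = appr (substλ-⟶ σ s)
substλ-⟶ σ (namξ s)     = namξ (substλ-⟶ σ s)
substλ-⟶ σ (muξ s)      = muξ (substλ-⟶ (↑μ ∘ σ) s)

infix 4 _⟶⁺_
_⟶⁺_ : Term → Term → Set
_⟶⁺_ = TransClosure _⟶_

rsub-β : ∀ k Q M P {τ} → τ ≗ sub₀ P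
       → (app (lam M) P) [ k :=r Q ] ⟶ (substλ τ M) [ k :=r Q ]
rsub-β k Q M P {τ} τ≗ = subst (_ ⟶_)
  (substλ-rsub τ (sub₀ (P [ k :=r Q ])) k (↑λ Q) Q sub₀≗ (substλ-sub₀-↑λ _ Q) M)
  β-sub₀
  where
  sub₀≗ : ∀ n → sub₀ (P [ k :=r Q ]) n ≡ (τ n) [ k :=r Q ]
  sub₀≗ zero    = cong (_[ k :=r Q ]) (sym (τ≗ zero))
  sub₀≗ (suc n) = cong (_[ k :=r Q ]) (sym (τ≗ (suc n)))

rsub-μ : ∀ k Q M P → (app (mu M) P) [ k :=r Q ] ⟶ (mu (M [ 0 :=r ↑μ P ])) [ k :=r Q ]
rsub-μ k Q M P = subst (app (mu (M [ suc k :=r ↑μ Q ])) (P [ k :=r Q ]) ⟶_)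
  (cong mu (sym (rsub-rsub-comm 0 (suc k) (↑μ P) (↑μ Q) (↑μ (P [ k :=r Q ])) (λ ())
    (rsub-↑μ k Q P) (rsub-renμ-fresh suc 0 _ (λ _ → refl) Q) M)))
  μr

rsub-ρ⁺ : ∀ k Q b M → (nam b (mu M)) [ k :=r Q ] ⟶⁺ (renμ (ρren b) M) [ k :=r Q ]
rsub-ρ⁺ k Q b M with ≡ᵇ-cases b k
... | inj₂ b≢k = subst₂ _⟶⁺_ (sym (rsub-nam-≢ b k (mu M) Q b≢k))
  (sym (rsub-renμ (ρren b) (suc k) k (↑μ Q) Q ρren⁻¹k (renμ-ρren-↑μ b Q) M))
  [ ρr ]
  where
  ρren⁻¹k : ∀ c → (ρren b c ≡ᵇ k) ≡ (c ≡ᵇ suc k)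
  ρren⁻¹k zero    = b≢k
  ρren⁻¹k (suc c) = refl
... | inj₁ b≡k = subst₂ _⟶⁺_ (sym (rsub-nam-≡ b k (mu M) Q b≡k))
  (sym (rsub-renμ-merge (ρren b) 0 (suc k) k (↑μ Q) (↑μ Q) Q ρren⁻¹k (λ ()) (renμ-ρren-↑μ b Q)
    (trans (cong (renμ (ρren b)) (rsub-renμ-fresh suc 0 _ (λ _ → refl) Q)) (renμ-ρren-↑μ b Q)) M))
  (namξ μr ∷ [ ρr ])
  where
  ρren⁻¹k : ∀ c → (ρren b c ≡ᵇ k) ≡ ((c ≡ᵇ 0) ∨ (c ≡ᵇ suc k))
  ρren⁻¹k zero    = b≡k
  ρren⁻¹k (suc c) = refl

rsub-ε : ∀ k Q M → (mu (mu M)) [ k :=r Q ] ⟶ (mu (erase 0 M)) [ k :=r Q ]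
rsub-ε k Q M = subst (mu (mu (M [ suc (suc k) :=r ↑μ (↑μ Q) ])) ⟶_)
  (cong mu (erase-rsub 0 (suc (suc k)) (suc k) (↑μ (↑μ Q)) (↑μ Q) refl punchOut⁻¹k
    (erase₀-↑μ (↑μ Q)) M))
  εr
  where
  punchOut⁻¹k : ∀ c → (c ≡ᵇ 0) ≡ false → (punchOut 0 c ≡ᵇ suc k) ≡ (c ≡ᵇ suc (suc k))
  punchOut⁻¹k (suc c) _ = refl

rsub-⟶⁺ : ∀ k Q {M M'} → M ⟶ M' → (M [ k :=r Q ]) ⟶⁺ (M' [ k :=r Q ])
rsub-⟶⁺ k Q (β {M} {P})  = [ rsub-β k Q M P (λ { zero → refl ; (suc n) → refl }) ]
rsub-⟶⁺ k Q (μr {M} {P}) = [ rsub-μ k Q M P ]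
rsub-⟶⁺ k Q (ρr {b} {M}) = rsub-ρ⁺ k Q b M
rsub-⟶⁺ k Q (θr {M})     = [ subst (λ t → mu (nam 0 t) ⟶ M [ k :=r Q ]) (sym (rsub-↑μ k Q M)) θr ]
rsub-⟶⁺ k Q (εr {M})     = [ rsub-ε k Q M ]
rsub-⟶⁺ k Q (lamξ s)     = TransClosure-map lamξ (rsub-⟶⁺ k (↑λ Q) s)
rsub-⟶⁺ k Q (appl s)     = TransClosure-map appl (rsub-⟶⁺ k Q s)
rsub-⟶⁺ k Q (appr s)     = TransClosure-map appr (rsub-⟶⁺ k Q s)
rsub-⟶⁺ k Q (namξ {a} s) with a ≡ᵇ k
... | true  = TransClosure-map (namξ ∘ appl) (rsub-⟶⁺ k Q s)
... | false = TransClosure-map namξ (rsub-⟶⁺ k Q s)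
rsub-⟶⁺ k Q (muξ s)      = TransClosure-map muξ (rsub-⟶⁺ (suc k) (↑μ Q) s)

SN-reflect : ∀ (f : Term → Term) → _⟶_ =[ f ]⇒ _⟶⁺_ → ∀ {M} → SN (f M) → SN M
SN-reflect f f-⟶⁺ sn-fM chain =
  sn-fM (InfiniteChain-flatten (InfiniteChain-map {S = _⟶⁺_} f f-⟶⁺ chain))

lemma4p12 : (M N : Term)
    → (∀ (x : ℕ) → SN (M [ x := N ]) → SN M)
    × (∀ (α : ℕ) → SN (M [ α :=r N ]) → SN M)
lemma4p12 M N =
    (λ x → SN-reflect (_[ x := N ]) ([_] ∘ substλ-⟶ _))
  , (λ α → SN-reflect (_[ α :=r N ]) (rsub-⟶⁺ α N))
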